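{- For all integers $2\le j\le k$, $$P_j(k)=\sum_{s=0}^j(-1)^s\binom{j}{s}k^{j-s}\frac{(s+k-j)!}{(k-j)!}>0.$$ -}

module Defs where

open import Data.Nat using (ℕ; zero; suc; _+_; _∸_; _^_; _!; _/_)
open import Data.Nat.Properties using (_!≢0)
open import Data.Nat.Combinatorics using (_C_)
open import Data.Integer as ℤ using (ℤ; +_)
open import Data.List using (List; map; upTo)
import Data.List as L

-- (s + k - j)! / (k - j)!  (exact natural-number quotient; used only for j ≤ k)
ratio : ℕ → ℕ → ℕ → ℕ
ratio j k s = (s + (k ∸ j)) ! / (k ∸ j) !
  where instance _ = (k ∸ j) !≢0

sign : ℕ → ℤ
sign zero = + 1
sign (suc s) = ℤ.- sign s

term : ℕ → ℕ → ℕ → ℤ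
term j k s = sign s ℤ.* (+ ((j C s) Data.Nat.* (k ^ (j ∸ s)) Data.Nat.* ratio j k s))

P : ℕ → ℕ → ℤ
P j k = L.foldr ℤ._+_ (+ 0) (map (term j k) (upTo (suc j)))

-- Free the base: for a, j, m ∈ ℕ put
--   Q j m = Σ_{s ≤ j} (-1)^s C(j,s) a^(j-s) (m+1)(m+2)⋯(m+s),
-- so that P_j(k) is Q j (k - j) with a = k. Pascal's rule gives
--   Q (j+1) m = a Q j m − (m+1) Q j (m+1),
-- and from it, by induction on j, Q (j+1) m − Q (j+1) (m+1) = (j+1) Q j (m+1).
-- Eliminating Q (j+1) (m+1) between the two yields
--   Q (j+2) m = (a−m−1) Q (j+1) m + (j+1)(m+1) Q j (m+1),
-- whose coefficients are natural numbers as long as j + m ≤ a. Hence Q j m is a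
-- natural number there, Q 2 m = (a−m−1)² + m + 1 > 0, and positivity propagates.
module Submission where

open import Defs
open import Data.Nat using (ℕ; _≤_)
open import Data.Integer using (+_; _>_)

open import Data.Nat as ℕ using (zero; suc; _∸_; _^_; _!; _<_; s≤s; z≤n)
import Data.Nat.Properties as ℕ
open import Data.Nat.DivMod using (m*n/n≡m)
open import Data.Nat.Combinatorics using (_C_; nCk+nC[k+1]≡[n+1]C[k+1]; k>n⇒nCk≡0)
import Data.Nat.Tactic.RingSolver as ℕ-Ring
open import Data.Integer using (ℤ; _+_; _*_; _-_; -_; +<+) renaming (_<_ to _<ℤ_)
import Data.Integer.Properties as ℤ
import Data.Integer.Tactic.RingSolver as ℤ-Ring
open import Algebra.Properties.CommutativeSemigroup ℤ.*-commutativeSemigroup using (x∙yz≈y∙xz)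
open import Data.List using (map; applyUpTo; foldr)
open import Function using (_∘_; id)
open import Relation.Binary.PropositionalEquality using (_≡_; refl; sym; trans; cong; cong₂; subst; module ≡-Reasoning)

∑ : ℕ → (ℕ → ℤ) → ℤ
∑ zero    f = + 0
∑ (suc n) f = f 0 + ∑ n (f ∘ suc)

foldr-map-applyUpTo : ∀ (g : ℕ → ℤ) (h : ℕ → ℕ) n →
                      foldr _+_ (+ 0) (map g (applyUpTo h n)) ≡ ∑ n (g ∘ h)
foldr-map-applyUpTo g h zero    = refl
foldr-map-applyUpTo g h (suc n) = cong (_+_ (g (h 0))) (foldr-map-applyUpTo g (h ∘ suc) n)

∑-cong : ∀ {f g : ℕ → ℤ} n → (∀ s → s < n → f s ≡ g s) → ∑ n f ≡ ∑ n g
∑-cong zero    f≡g = refl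
∑-cong (suc n) f≡g = cong₂ _+_ (f≡g 0 (s≤s z≤n)) (∑-cong n (λ s s<n → f≡g (suc s) (s≤s s<n)))

∑-distrib-- : ∀ (f g : ℕ → ℤ) n → ∑ n (λ s → f s - g s) ≡ ∑ n f - ∑ n g
∑-distrib-- f g zero    = refl
∑-distrib-- f g (suc n) = begin
  f 0 - g 0 + ∑ n (λ s → f (suc s) - g (suc s))  ≡⟨ cong (_+_ (f 0 - g 0)) (∑-distrib-- (f ∘ suc) (g ∘ suc) n) ⟩
  f 0 - g 0 + (∑ n (f ∘ suc) - ∑ n (g ∘ suc))    ≡⟨ shuffle (f 0) (g 0) (∑ n (f ∘ suc)) (∑ n (g ∘ suc)) ⟩
  f 0 + ∑ n (f ∘ suc) - (g 0 + ∑ n (g ∘ suc))    ∎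
  where
  open ≡-Reasoning
  shuffle : ∀ x y u v → x - y + (u - v) ≡ x + u - (y + v)
  shuffle = ℤ-Ring.solve-∀

∑-distribˡ-* : ∀ c (f : ℕ → ℤ) n → ∑ n (λ s → c * f s) ≡ c * ∑ n f
∑-distribˡ-* c f zero    = sym (ℤ.*-zeroʳ c)
∑-distribˡ-* c f (suc n) = trans (cong (_+_ (c * f 0)) (∑-distribˡ-* c (f ∘ suc) n))
                                 (sym (ℤ.*-distribˡ-+ c (f 0) (∑ n (f ∘ suc))))

∑-suc-last : ∀ (f : ℕ → ℤ) n → ∑ (suc n) f ≡ ∑ n f + f n
∑-suc-last f zero    = ℤ.+-comm (f 0) (+ 0)
∑-suc-last f (suc n) = trans (cong (_+_ (f 0)) (∑-suc-last (f ∘ suc) n))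
                             (sym (ℤ.+-assoc (f 0) (∑ n (f ∘ suc)) (f (suc n))))

∑-drop-last-zero : ∀ (f : ℕ → ℤ) n → f n ≡ + 0 → ∑ (suc n) f ≡ ∑ n f
∑-drop-last-zero f n fn≡0 = trans (∑-suc-last f n) (trans (cong (_+_ (∑ n f)) fn≡0) (ℤ.+-identityʳ (∑ n f)))

-- rising m s is the rising factorial (m + 1)⁽ˢ⁾, not m⁽ˢ⁾.
rising : ℕ → ℕ → ℕ
rising m zero    = 1
rising m (suc s) = suc m ℕ.* rising (suc m) s

[s+m]!≡rising*m! : ∀ s m → (s ℕ.+ m) ! ≡ rising m s ℕ.* m !
[s+m]!≡rising*m! zero    m = sym (ℕ.+-identityʳ (m !))
[s+m]!≡rising*m! (suc s) m = begin
  suc (s ℕ.+ m) !                        ≡⟨ cong _! (sym (ℕ.+-suc s m)) ⟩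
  (s ℕ.+ suc m) !                        ≡⟨ [s+m]!≡rising*m! s (suc m) ⟩
  rising (suc m) s ℕ.* (suc m ℕ.* m !)   ≡⟨ reassoc (rising (suc m) s) (suc m) (m !) ⟩
  suc m ℕ.* rising (suc m) s ℕ.* m !     ∎
  where
  open ≡-Reasoning
  reassoc : ∀ x y z → x ℕ.* (y ℕ.* z) ≡ y ℕ.* x ℕ.* z
  reassoc = ℕ-Ring.solve-∀

ratio≡rising : ∀ j k s → ratio j k s ≡ rising (k ∸ j) s
ratio≡rising j k s = trans (cong (λ x → (x ℕ./ m !) {{m ℕ.!≢0}}) ([s+m]!≡rising*m! s m))
                           (m*n/n≡m (rising m s) (m !) {{m ℕ.!≢0}})
  where m = k ∸ j

module _ (a : ℕ) where

  -- The exponent e is kept apart from j because Pascal's rule lowers j without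
  -- lowering the power of a.
  summand : ℕ → ℕ → ℕ → ℕ → ℤ
  summand e j m s = sign s * + ((j C s) ℕ.* a ^ (e ∸ s) ℕ.* rising m s)

  Q : ℕ → ℕ → ℤ
  Q j m = ∑ (suc j) (summand j j m)

  summand-pascal : ∀ e j m s → summand (suc e) (suc j) m (suc s)
                               ≡ summand (suc e) j m (suc s) - + suc m * summand e j (suc m) s
  summand-pascal e j m s = begin
    - sign s * + ((suc j C suc s) ℕ.* p ℕ.* (suc m ℕ.* r))
      ≡⟨ cong (λ c → - sign s * + (c ℕ.* p ℕ.* (suc m ℕ.* r))) (sym (nCk+nC[k+1]≡[n+1]C[k+1] j s)) ⟩
    - sign s * + ((x ℕ.+ y) ℕ.* p ℕ.* (suc m ℕ.* r))
      ≡⟨ cong (λ n → - sign s * + n) (split x y p (suc m) r) ⟩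
    - sign s * (+ (y ℕ.* p ℕ.* (suc m ℕ.* r)) + + (suc m ℕ.* (x ℕ.* p ℕ.* r)))
      ≡⟨ cong (λ z → - sign s * (+ (y ℕ.* p ℕ.* (suc m ℕ.* r)) + z)) (ℤ.pos-* (suc m) (x ℕ.* p ℕ.* r)) ⟩
    - sign s * (+ (y ℕ.* p ℕ.* (suc m ℕ.* r)) + + suc m * + (x ℕ.* p ℕ.* r))
      ≡⟨ distribute (sign s) (+ (y ℕ.* p ℕ.* (suc m ℕ.* r))) (+ suc m) (+ (x ℕ.* p ℕ.* r)) ⟩
    - sign s * + (y ℕ.* p ℕ.* (suc m ℕ.* r)) - + suc m * (sign s * + (x ℕ.* p ℕ.* r))
      ∎
    where
    open ≡-Reasoning
    x = j C s
    y = j C suc s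
    p = a ^ (e ∸ s)
    r = rising (suc m) s
    split : ∀ x y p c r → (x ℕ.+ y) ℕ.* p ℕ.* (c ℕ.* r) ≡ y ℕ.* p ℕ.* (c ℕ.* r) ℕ.+ c ℕ.* (x ℕ.* p ℕ.* r)
    split = ℕ-Ring.solve-∀
    distribute : ∀ σ u c v → - σ * (u + c * v) ≡ - σ * u - c * (σ * v)
    distribute = ℤ-Ring.solve-∀

  summand-raise : ∀ e j m s → s ≤ e → summand (suc e) j m s ≡ + a * summand e j m s
  summand-raise e j m s s≤e = begin
    sign s * + ((j C s) ℕ.* a ^ (suc e ∸ s) ℕ.* rising m s)
      ≡⟨ cong (λ n → sign s * + ((j C s) ℕ.* a ^ n ℕ.* rising m s)) (ℕ.+-∸-assoc 1 s≤e) ⟩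
    sign s * + ((j C s) ℕ.* (a ℕ.* a ^ (e ∸ s)) ℕ.* rising m s)
      ≡⟨ cong (λ n → sign s * + n) (pull-out (j C s) a (a ^ (e ∸ s)) (rising m s)) ⟩
    sign s * + (a ℕ.* ((j C s) ℕ.* a ^ (e ∸ s) ℕ.* rising m s))
      ≡⟨ cong (sign s *_) (ℤ.pos-* a _) ⟩
    sign s * (+ a * + ((j C s) ℕ.* a ^ (e ∸ s) ℕ.* rising m s))
      ≡⟨ x∙yz≈y∙xz (sign s) (+ a) _ ⟩
    + a * summand e j m s
      ∎
    where
    open ≡-Reasoning
    pull-out : ∀ x b p r → x ℕ.* (b ℕ.* p) ℕ.* r ≡ b ℕ.* (x ℕ.* p ℕ.* r)
    pull-out = ℕ-Ring.solve-∀

  summand-vanish : ∀ e j m s → j < s → summand e j m s ≡ + 0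
  summand-vanish e j m s j<s rewrite k>n⇒nCk≡0 j<s = ℤ.*-zeroʳ (sign s)

  Q-suc : ∀ j m → Q (suc j) m ≡ + a * Q j m - + suc m * Q j (suc m)
  Q-suc j m = begin
    U 0 + ∑ (suc j) (summand (suc j) (suc j) m ∘ suc)
      ≡⟨ cong (_+_ (U 0)) (∑-cong (suc j) (λ s _ → summand-pascal j j m s)) ⟩
    U 0 + ∑ (suc j) (λ s → U (suc s) - + suc m * summand j j (suc m) s)
      ≡⟨ cong (_+_ (U 0)) (∑-distrib-- (U ∘ suc) (λ s → + suc m * summand j j (suc m) s) (suc j)) ⟩
    U 0 + (∑ (suc j) (U ∘ suc) - ∑ (suc j) (λ s → + suc m * summand j j (suc m) s))
      ≡⟨ sym (ℤ.+-assoc (U 0) _ _) ⟩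
    ∑ (suc (suc j)) U - ∑ (suc j) (λ s → + suc m * summand j j (suc m) s)
      ≡⟨ cong₂ _-_ (∑-drop-last-zero U (suc j) (summand-vanish (suc j) j m (suc j) (ℕ.n<1+n j)))
                   (∑-distribˡ-* (+ suc m) (summand j j (suc m)) (suc j)) ⟩
    ∑ (suc j) U - + suc m * Q j (suc m)
      ≡⟨ cong (_- + suc m * Q j (suc m))
              (trans (∑-cong (suc j) (λ s s≤j → summand-raise j j m s (ℕ.≤-pred s≤j)))
                     (∑-distribˡ-* (+ a) (summand j j m) (suc j))) ⟩
    + a * Q j m - + suc m * Q j (suc m)
      ∎
    where
    open ≡-Reasoning
    U = summand (suc j) j m

  Q-difference : ∀ j m → Q (suc j) m - Q (suc j) (suc m) ≡ + suc j * Q j (suc m)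
  Q-difference zero m = trans (cong₂ _-_ (Q-suc 0 m) (Q-suc 0 (suc m))) (first-difference (+ a) (+ m))
    where
    first-difference : ∀ a m → (a * + 1 - (+ 1 + m) * + 1) - (a * + 1 - (+ 1 + (+ 1 + m)) * + 1) ≡ + 1 * + 1
    first-difference = ℤ-Ring.solve-∀
  Q-difference (suc j) m = begin
    Q (suc (suc j)) m - Q (suc (suc j)) (suc m)
      ≡⟨ cong₂ _-_ (Q-suc (suc j) m) (Q-suc (suc j) (suc m)) ⟩
    (A * X₀ - c * X₁) - (A * X₁ - (+ 1 + c) * X₂)
      ≡⟨ regroup A c X₀ X₁ X₂ ⟩
    A * (X₀ - X₁) - c * (X₁ - X₂) + X₂
      ≡⟨ cong₂ (λ u v → A * u - c * v + X₂) (Q-difference j m) (Q-difference j (suc m)) ⟩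
    A * (J * Y₁) - c * (J * Y₂) + X₂
      ≡⟨ regroup′ A c J Y₁ Y₂ X₂ ⟩
    J * (A * Y₁ - (+ 1 + c) * Y₂) + (X₂ + J * Y₂)
      ≡⟨ cong₂ (λ u v → J * u + v) (sym (Q-suc j (suc m))) (x-y≡z⇒y+z≡x (Q-difference j (suc m))) ⟩
    J * X₁ + X₁
      ≡⟨ collect J X₁ ⟩
    (+ 1 + J) * X₁
      ∎
    where
    open ≡-Reasoning
    A = + a
    c = + suc m
    J = + suc j
    X₀ = Q (suc j) m
    X₁ = Q (suc j) (suc m)
    X₂ = Q (suc j) (suc (suc m))
    Y₁ = Q j (suc m)
    Y₂ = Q j (suc (suc m))
    regroup : ∀ A c x₀ x₁ x₂ → (A * x₀ - c * x₁) - (A * x₁ - (+ 1 + c) * x₂)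
                              ≡ A * (x₀ - x₁) - c * (x₁ - x₂) + x₂
    regroup = ℤ-Ring.solve-∀
    regroup′ : ∀ A c J y₁ y₂ x₂ → A * (J * y₁) - c * (J * y₂) + x₂
                                  ≡ J * (A * y₁ - (+ 1 + c) * y₂) + (x₂ + J * y₂)
    regroup′ = ℤ-Ring.solve-∀
    collect : ∀ J x → J * x + x ≡ (+ 1 + J) * x
    collect = ℤ-Ring.solve-∀
    y+[x-y]≡x : ∀ x y → y + (x - y) ≡ x
    y+[x-y]≡x = ℤ-Ring.solve-∀
    x-y≡z⇒y+z≡x : ∀ {x y z} → x - y ≡ z → y + z ≡ x
    x-y≡z⇒y+z≡x {x} {y} refl = y+[x-y]≡x x y

  +[a∸c]≡+a-+c : ∀ c → c ≤ a → + (a ∸ c) ≡ + a - + c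
  +[a∸c]≡+a-+c c c≤a = sym (trans (ℤ.m-n≡m⊖n a c) (ℤ.⊖-≥ c≤a))

  Q-suc-suc : ∀ j m → suc m ≤ a →
              Q (suc (suc j)) m ≡ + (a ∸ suc m) * Q (suc j) m + + suc m * (+ suc j * Q j (suc m))
  Q-suc-suc j m m<a = begin
    Q (suc (suc j)) m
      ≡⟨ Q-suc (suc j) m ⟩
    + a * Q (suc j) m - + suc m * Q (suc j) (suc m)
      ≡⟨ regroup (+ a) (+ suc m) (Q (suc j) m) (Q (suc j) (suc m)) ⟩
    (+ a - + suc m) * Q (suc j) m + + suc m * (Q (suc j) m - Q (suc j) (suc m))
      ≡⟨ cong₂ (λ u v → u * Q (suc j) m + + suc m * v) (sym (+[a∸c]≡+a-+c (suc m) m<a)) (Q-difference j m) ⟩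
    + (a ∸ suc m) * Q (suc j) m + + suc m * (+ suc j * Q j (suc m))
      ∎
    where
    open ≡-Reasoning
    regroup : ∀ A c x₀ x₁ → A * x₀ - c * x₁ ≡ (A - c) * x₀ + c * (x₀ - x₁)
    regroup = ℤ-Ring.solve-∀

  Qℕ : ℕ → ℕ → ℕ
  Qℕ zero          m = 1
  Qℕ (suc zero)    m = a ∸ suc m
  Qℕ (suc (suc j)) m = (a ∸ suc m) ℕ.* Qℕ (suc j) m ℕ.+ suc m ℕ.* (suc j ℕ.* Qℕ j (suc m))

  Q≡+Qℕ : ∀ j m → j ℕ.+ m ≤ a → Q j m ≡ + Qℕ j m
  Q≡+Qℕ zero          m _ = refl
  Q≡+Qℕ (suc zero)    m m<a = trans (Q-suc 0 m) (trans (drop-ones (+ a) (+ suc m)) (sym (+[a∸c]≡+a-+c (suc m) m<a)))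
    where
    drop-ones : ∀ A c → A * + 1 - c * + 1 ≡ A - c
    drop-ones = ℤ-Ring.solve-∀
  Q≡+Qℕ (suc (suc j)) m 2+j+m≤a = begin
    Q (suc (suc j)) m
      ≡⟨ Q-suc-suc j m (ℕ.≤-trans (s≤s (ℕ.m≤n+m m (suc j))) 2+j+m≤a) ⟩
    + (a ∸ suc m) * Q (suc j) m + + suc m * (+ suc j * Q j (suc m))
      ≡⟨ cong₂ (λ u v → + (a ∸ suc m) * u + + suc m * (+ suc j * v))
               (Q≡+Qℕ (suc j) m (ℕ.<⇒≤ 2+j+m≤a))
               (Q≡+Qℕ j (suc m) (subst (_≤ a) (sym (ℕ.+-suc j m)) (ℕ.<⇒≤ 2+j+m≤a))) ⟩
    + (a ∸ suc m) * + Qℕ (suc j) m + + suc m * (+ suc j * + Qℕ j (suc m))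
      ≡⟨ sym (cong₂ _+_ (ℤ.pos-* (a ∸ suc m) _)
                        (trans (ℤ.pos-* (suc m) _) (cong (+ suc m *_) (ℤ.pos-* (suc j) _)))) ⟩
    + Qℕ (suc (suc j)) m
      ∎
    where open ≡-Reasoning

  Qℕ-pos : ∀ j m → suc (suc j) ℕ.+ m ≤ a → 0 < Qℕ (suc (suc j)) m
  Qℕ-pos zero    m _ = ℕ.<-≤-trans ℕ.0<1+n (ℕ.m≤n+m _ _)
  Qℕ-pos (suc j) m 3+j+m≤a =
    ℕ.<-≤-trans (ℕ.*-mono-< (ℕ.m<n⇒0<n∸m m+1<a) (Qℕ-pos j m (ℕ.<⇒≤ 3+j+m≤a))) (ℕ.m≤m+n _ _)
    where
    m+1<a : suc m < a
    m+1<a = ℕ.≤-trans (s≤s (s≤s (ℕ.m≤n+m m (suc j)))) 3+j+m≤a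

  Q-pos : ∀ j m → suc (suc j) ℕ.+ m ≤ a → + 0 <ℤ Q (suc (suc j)) m
  Q-pos j m 2+j+m≤a = subst (+ 0 <ℤ_) (sym (Q≡+Qℕ (suc (suc j)) m 2+j+m≤a)) (+<+ (Qℕ-pos j m 2+j+m≤a))

P≡Q : ∀ j k → P j k ≡ Q k j (k ∸ j)
P≡Q j k = trans (foldr-map-applyUpTo (term j k) id (suc j))
                (∑-cong (suc j) (λ s _ → cong (λ r → sign s * + ((j C s) ℕ.* k ^ (j ∸ s) ℕ.* r)) (ratio≡rising j k s)))

lemma4p4 : (j k : ℕ) → 2 ≤ j → j ≤ k → P j k > + 0
lemma4p4 (suc (suc j)) k (s≤s (s≤s _)) j≤k =
  subst (+ 0 <ℤ_) (sym (P≡Q (suc (suc j)) k))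
        (Q-pos k j (k ∸ suc (suc j)) (ℕ.≤-reflexive (ℕ.m+[n∸m]≡n j≤k)))
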